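{- Any tableau construction for an LTL formula $\phi$ following the rules terminates: there are no infinitely long branches, so the finished tableau has either at least one ticked leaf (a leaf marked with a tick, indicating a successful branch) or all leaves crossed.
   Context: The tableau for $\phi$ is a tree with root labelled $\{\phi\}$ and nodes labelled by sets of formulas from the finite closure set of $\phi$ (subformulas, their negations, and $X(\alpha U\beta)$, $\neg X(\alpha U\beta)$ for subformulas $\alpha U\beta$). Static rules consume a formula from the parent label between uses of TRANSITION. On poised labels (non-empty, contradiction-free, all formulas atoms, negated atoms, $X\alpha$ or $\neg X\alpha$), LOOP ticks $v$ if a proper ancestor $u$ has poised $\Gamma_u\supseteq\Gamma_v$ and all $X$-eventualities $X(\alpha U\beta)$/$XF\beta$ of $\Gamma_u$ are fulfilled ($\beta$ appears) strictly after $u$ up to $v$; PRUNE crosses $w$ when $u<v<w$ share the same poised label and no new eventuality is fulfilled in $(v,w]$ beyond those fulfilled in $(u,v]$; PRUNE$_0$ crosses $v$ when $u<v$ share a poised label with an $X$-eventuality none of which is fulfilled in $(u,v]$; otherwise TRANSITION passes to the next time point. -}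

module Defs where

open import Data.Nat using (ℕ; suc; _<_; _≤_)
open import Data.List using (List; [_])
open import Data.List.Membership.Propositional using (_∈_)
open import Data.List.Relation.Binary.Subset.Propositional using (_⊆_)
open import Data.List.Relation.Unary.All using (All)
open import Data.Product using (_×_; ∃; ∃-syntax)
open import Data.Sum using (_⊎_)
open import Relation.Binary.PropositionalEquality using (_≡_; _≢_)
open import Relation.Nullary using (¬_)

infixr 6 _∧'_
infixr 5 _U_

data Fml : Set where
  atom : ℕ → Fml
  ¬'   : Fml → Fml
  _∧'_ : Fml → Fml → Fml
  X    : Fml → Fml
  _U_  : Fml → Fml → Fml

-- Labels: finite sets of formulas, represented by lists (only membership matters)
Label : Set
Label = List Fml

_≋_ : Label → Label → Set
Γ ≋ Δ = (Γ ⊆ Δ) × (Δ ⊆ Γ)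

IsRuleChild : Label → Fml → Label → Label → Set
IsRuleChild Γ f new Δ =
  ∀ ψ → (ψ ∈ Δ → (ψ ∈ new ⊎ (ψ ∈ Γ × ψ ≢ f)))
      × ((ψ ∈ new ⊎ (ψ ∈ Γ × ψ ≢ f)) → ψ ∈ Δ)

data StaticChild (Γ Δ : Label) : Set where
  dneg : ∀ {α} → ¬' (¬' α) ∈ Γ → IsRuleChild Γ (¬' (¬' α)) [ α ] Δ → StaticChild Γ Δ
  con  : ∀ {α β} → (α ∧' β) ∈ Γ →
         IsRuleChild Γ (α ∧' β) (α Data.List.∷ β Data.List.∷ Data.List.[]) Δ → StaticChild Γ Δ
  dis₁ : ∀ {α β} → ¬' (α ∧' β) ∈ Γ → IsRuleChild Γ (¬' (α ∧' β)) [ ¬' α ] Δ → StaticChild Γ Δ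
  dis₂ : ∀ {α β} → ¬' (α ∧' β) ∈ Γ → IsRuleChild Γ (¬' (α ∧' β)) [ ¬' β ] Δ → StaticChild Γ Δ
  unt₁ : ∀ {α β} → (α U β) ∈ Γ → IsRuleChild Γ (α U β) [ β ] Δ → StaticChild Γ Δ
  unt₂ : ∀ {α β} → (α U β) ∈ Γ →
         IsRuleChild Γ (α U β) (α Data.List.∷ X (α U β) Data.List.∷ Data.List.[]) Δ → StaticChild Γ Δ
  nunt₁ : ∀ {α β} → ¬' (α U β) ∈ Γ →
          IsRuleChild Γ (¬' (α U β)) (¬' α Data.List.∷ ¬' β Data.List.∷ Data.List.[]) Δ → StaticChild Γ Δ
  nunt₂ : ∀ {α β} → ¬' (α U β) ∈ Γ →
          IsRuleChild Γ (¬' (α U β)) (¬' β Data.List.∷ ¬' (X (α U β)) Data.List.∷ Data.List.[]) Δ →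
          StaticChild Γ Δ

data Elementary : Fml → Set where
  e-atom  : ∀ {p} → Elementary (atom p)
  e-natom : ∀ {p} → Elementary (¬' (atom p))
  e-X     : ∀ {α} → Elementary (X α)
  e-nX    : ∀ {α} → Elementary (¬' (X α))

Contradictory : Label → Set
Contradictory Γ = ∃[ α ] (α ∈ Γ × ¬' α ∈ Γ)

NonEmpty : Label → Set
NonEmpty Γ = ∃[ ψ ] (ψ ∈ Γ)

Poised : Label → Set
Poised Γ = NonEmpty Γ × ¬ Contradictory Γ × All Elementary Γ

TransChild : Label → Label → Set
TransChild Γ Δ =
  ∀ ψ → (ψ ∈ Δ → (X ψ ∈ Γ ⊎ ∃[ α ] (ψ ≡ ¬' α × ¬' (X α) ∈ Γ)))
      × ((X ψ ∈ Γ ⊎ ∃[ α ] (ψ ≡ ¬' α × ¬' (X α) ∈ Γ)) → ψ ∈ Δ)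

-- Branches: B i is the label of the i-th node (B 0 the root)

Branch : Set
Branch = ℕ → Label

FulfilledIn : Branch → ℕ → ℕ → Fml → Set
FulfilledIn B u v β = ∃[ k ] (u < k × k ≤ v × β ∈ B k)

Loop : Branch → ℕ → Set
Loop B v = ∃[ u ] (u < v × Poised (B u) × B v ⊆ B u ×
             (∀ α β → X (α U β) ∈ B u → FulfilledIn B u v β))

Prune : Branch → ℕ → Set
Prune B w = ∃[ u ] ∃[ v ] (u < v × v < w × Poised (B u) × B u ≋ B v × B v ≋ B w ×
              (∀ α β → X (α U β) ∈ B w → FulfilledIn B v w β → FulfilledIn B u v β))

Prune₀ : Branch → ℕ → Set
Prune₀ B v = ∃[ u ] (u < v × Poised (B u) × B u ≋ B v ×
               (∃[ α ] ∃[ β ] (X (α U β) ∈ B v)) ×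
               (∀ α β → X (α U β) ∈ B v → ¬ FulfilledIn B u v β))

-- Node i of B is not a leaf and node (suc i) is a child of it by some rule.
-- Leaves: empty label (EMPTY, ticked), contradictory label (crossed),
-- LOOP (ticked), PRUNE / PRUNE₀ (crossed).
Continues : Branch → ℕ → Set
Continues B i =
    (NonEmpty (B i) × ¬ Contradictory (B i) × StaticChild (B i) (B (suc i)))
  ⊎ (Poised (B i) × ¬ Loop B i × ¬ Prune B i × ¬ Prune₀ B i × TransChild (B i) (B (suc i)))

InfiniteBranch : Fml → Branch → Set
InfiniteBranch φ B = (B 0 ≋ [ φ ]) × (∀ i → Continues B i)

-- Every label of a branch lies in the finite closure of φ. A static rule replaces a
-- formula by formulas of smaller static size (X-formulas have size 0), so a run of
-- static steps never reaches a superset of one of its earlier labels; hence poised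
-- labels occur infinitely often, and some poised label Γ recurs infinitely often.
-- Fix an occurrence u of Γ. Along the later occurrences the set of X-eventualities
-- of Γ fulfilled since u only grows, so it stops growing between two occurrences
-- v < w, and then PRUNE applies at w: the branch cannot continue there.
module Submission where

open import Defs
open import Data.Empty using (⊥-elim)
open import Data.List using (List; []; _∷_; [_]; _++_; map)
open import Data.List.Membership.Propositional using (_∈_; _∉_)
open import Data.List.Membership.Propositional.Properties using (∈-map⁺; ∈-++⁺ˡ; ∈-++⁺ʳ)
open import Data.List.Relation.Binary.Subset.Propositional using (_⊆_)
open import Data.List.Relation.Unary.All using (All; []; _∷_)
import Data.List.Relation.Unary.All as All
open import Data.List.Relation.Unary.Any using (here; there)
open import Data.Nat using (ℕ; zero; suc; _+_; _⊔_; _≤_; _<_; _≤′_; ≤′-refl; ≤′-step; s≤s; z<s)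
open import Data.Nat.Properties
open import Data.Product using (∃; ∃-syntax; _×_; _,_; proj₁; proj₂)
open import Data.Sum using (_⊎_; inj₁; inj₂; [_,_]′)
open import Data.Unit using (⊤; tt)
open import Function using (_∘_)
open import Relation.Binary.PropositionalEquality using (refl; cong)
open import Relation.Nullary using (¬_; yes; no)
open import Relation.Nullary.Decidable.Core using (¬¬-excluded-middle)

argmax : (f : ℕ → ℕ) {i j : ℕ} → i < j →
         ∃[ k ] (i ≤ k × k < j × (∀ {k′} → i ≤ k′ → k′ < j → f k′ ≤ f k))
argmax f {i} {suc j} i<1+j with m<1+n⇒m<n∨m≡n i<1+j
... | inj₂ refl = i , ≤-refl , ≤-refl ,
  λ i≤k′ k′<1+i → ≤-reflexive (cong f (≤-antisym (m<1+n⇒m≤n k′<1+i) i≤k′))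
... | inj₁ i<j with argmax f i<j
...   | k , i≤k , k<j , max with ≤-total (f j) (f k)
...     | inj₁ fj≤fk = k , i≤k , m<n⇒m<1+n k<j ,
  λ i≤k′ k′<1+j → [ max i≤k′ , (λ { refl → fj≤fk }) ]′ (m<1+n⇒m<n∨m≡n k′<1+j)
...     | inj₂ fk≤fj = j , <⇒≤ i<j , ≤-refl ,
  λ i≤k′ k′<1+j → [ (λ k′<j → ≤-trans (max i≤k′ k′<j) fk≤fj) , (λ { refl → ≤-refl }) ]′
                    (m<1+n⇒m<n∨m≡n k′<1+j)

module _ {A : Set} (rank : A → ℕ) where

  record Consumes (Γ Δ : List A) (g : A) : Set where
    field
      consumed∈ : g ∈ Γ
      consumed∉ : g ∉ Δ
      fresh-lower : ∀ {x} → x ∈ Δ → x ∈ Γ ⊎ rank x < rank g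

  -- The consumed element of maximal rank in [i, j) is in L i but not in L j.
  consuming-run⇒¬⊆ : (L : ℕ → List A) → (∀ k → ∃ (Consumes (L k) (L (suc k)))) →
                     ∀ {i j} → i < j → ¬ (L i ⊆ L j)
  consuming-run⇒¬⊆ L steps {i} {j} i<j Li⊆Lj with argmax (rank ∘ proj₁ ∘ steps) i<j
  ... | k , i≤k , k<j , maximal =
    consumed∉ (step k) (persists-backwards (≤⇒≤′ k<j) after-k (Li⊆Lj g-k∈L-i))
    where
    open Consumes
    g : ℕ → A
    g = proj₁ ∘ steps
    step : ∀ k → Consumes (L k) (L (suc k)) (g k)
    step = proj₂ ∘ steps

    persists-backwards : ∀ {x i j} → i ≤′ j → (∀ {k} → i ≤ k → k < j → rank (g k) ≤ rank x) →
                         x ∈ L j → x ∈ L i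
    persists-backwards ≤′-refl _ x∈Lj = x∈Lj
    persists-backwards (≤′-step {j} i≤′j) bounded x∈L1+j with fresh-lower (step j) x∈L1+j
    ... | inj₁ x∈Lj = persists-backwards i≤′j (λ i≤k k<j → bounded i≤k (m<n⇒m<1+n k<j)) x∈Lj
    ... | inj₂ x<gj = ⊥-elim (<⇒≱ x<gj (bounded (≤′⇒≤ i≤′j) ≤-refl))

    before-k : ∀ {k′} → i ≤ k′ → k′ < k → rank (g k′) ≤ rank (g k)
    before-k i≤k′ k′<k = maximal i≤k′ (<-trans k′<k k<j)

    after-k : ∀ {k′} → suc k ≤ k′ → k′ < j → rank (g k′) ≤ rank (g k)
    after-k k<k′ k′<j = maximal (≤-trans i≤k (<⇒≤ k<k′)) k′<j

    g-k∈L-i : g k ∈ L i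
    g-k∈L-i = persists-backwards (≤⇒≤′ i≤k) before-k (consumed∈ (step k))

-- Classical "S holds infinitely often", double-negated so that case distinctions can be
-- made by ¬¬-excluded-middle while proving ⊥.
InfinitelyOften : (ℕ → Set) → Set
InfinitelyOften S = ∀ n → ¬ ¬ (∃[ m ] (n ≤ m × S m))

InfinitelyOften-≥ : ∀ {S} n → InfinitelyOften S → InfinitelyOften (λ m → n ≤ m × S m)
InfinitelyOften-≥ n often n′ k = often (n ⊔ n′) λ (m , n⊔n′≤m , Sm) →
  k (m , ≤-trans (m≤n⊔m n n′) n⊔n′≤m , ≤-trans (m≤m⊔n n n′) n⊔n′≤m , Sm)

InfinitelyOften⇒pair : ∀ {S} → InfinitelyOften S → ¬ ¬ (∃[ i ] ∃[ j ] (i < j × S i × S j))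
InfinitelyOften⇒pair often k =
  often 0 λ (i , _ , Si) → often (suc i) λ (j , i<j , Sj) → k (i , j , i<j , Si , Sj)

module _ {A : Set} (P : A → ℕ → Set) where

  ConstantOn : (ℕ → Set) → A → Set
  ConstantOn S x = ∀ {m m′} → S m → S m′ → P x m → P x m′

  pigeonhole : (C : List A) {S : ℕ → Set} → InfinitelyOften S →
               ¬ ¬ (∃[ S′ ] (InfinitelyOften S′ × (∀ {m} → S′ m → S m) ×
                             (∀ {x} → x ∈ C → ConstantOn S′ x)))
  pigeonhole [] {S} often k = k (S , often , (λ Sm → Sm) , λ ())
  pigeonhole (x ∷ C) {S} often k = ¬¬-excluded-middle {A = InfinitelyOften (λ m → S m × P x m)} λ
    { (yes often-x) → pigeonhole C often-x λ (S′ , often′ , sub , constant) →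
        k (S′ , often′ , proj₁ ∘ sub ,
           λ { (here refl) _ S′m′ _ → proj₂ (sub S′m′) ; (there x′∈C) → constant x′∈C })
    ; (no rarely-x) → rarely-x λ n never-x → pigeonhole C (InfinitelyOften-≥ n often)
        λ (S′ , often′ , sub , constant) →
        k (S′ , often′ , proj₂ ∘ sub ,
           λ { (here refl) S′m _ Pxm →
                 ⊥-elim (never-x (_ , proj₁ (sub S′m) , proj₂ (sub S′m) , Pxm))
             ; (there x′∈C) → constant x′∈C }) }

recurring-label : ∀ {A : Set} {S} (L : ℕ → List A) (C : List A) → (∀ k → L k ⊆ C) →
                  InfinitelyOften S →
                  ¬ ¬ (∃[ S′ ] (InfinitelyOften S′ × (∀ {m} → S′ m → S m) ×
                                (∀ {m m′} → S′ m → S′ m′ → L m ⊆ L m′)))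
recurring-label L C L⊆C often k = pigeonhole (λ x m → x ∈ L m) C often
  λ (S′ , often′ , sub , constant) →
  k (S′ , often′ , sub , λ S′m S′m′ x∈Lm → constant (L⊆C _ x∈Lm) S′m S′m′ x∈Lm)

module _ {A : Set} (G : ℕ → A → Set) (monotone : ∀ {v w x} → v ≤ w → G v x → G w x) where

  monotone-stabilises : (E : List A) {S : ℕ → Set} → InfinitelyOften S →
                        ¬ ¬ (∃[ v ] ∃[ w ] (v < w × S v × S w × (∀ {x} → x ∈ E → G w x → G v x)))
  monotone-stabilises [] often k =
    InfinitelyOften⇒pair often λ (v , w , v<w , Sv , Sw) → k (v , w , v<w , Sv , Sw , λ ())
  monotone-stabilises (x ∷ E) {S} often k = ¬¬-excluded-middle {A = ∃[ v ] (S v × G v x)} λ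
    { (yes (v₀ , _ , Gv₀x)) → monotone-stabilises E (InfinitelyOften-≥ v₀ often)
        λ (v , w , v<w , (v₀≤v , Sv) , (_ , Sw) , stable) →
        k (v , w , v<w , Sv , Sw ,
           λ { (here refl) _ → monotone v₀≤v Gv₀x ; (there x′∈E) → stable x′∈E })
    ; (no never) → monotone-stabilises E often
        λ (v , w , v<w , Sv , Sw , stable) →
        k (v , w , v<w , Sv , Sw ,
           λ { (here refl) Gwx → ⊥-elim (never (w , Sw , Gwx)) ; (there x′∈E) → stable x′∈E }) }

infix 4 _⊑_

data _⊑_ (ψ : Fml) : Fml → Set where
  ⊑-refl : ψ ⊑ ψ
  ⊑-¬    : ∀ {α} → ψ ⊑ α → ψ ⊑ ¬' α
  ⊑-∧ˡ   : ∀ {α β} → ψ ⊑ α → ψ ⊑ α ∧' β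
  ⊑-∧ʳ   : ∀ {α β} → ψ ⊑ β → ψ ⊑ α ∧' β
  ⊑-X    : ∀ {α} → ψ ⊑ α → ψ ⊑ X α
  ⊑-Uˡ   : ∀ {α β} → ψ ⊑ α → ψ ⊑ α U β
  ⊑-Uʳ   : ∀ {α β} → ψ ⊑ β → ψ ⊑ α U β

⊑-trans : ∀ {χ ψ φ} → χ ⊑ ψ → ψ ⊑ φ → χ ⊑ φ
⊑-trans p ⊑-refl   = p
⊑-trans p (⊑-¬ q)  = ⊑-¬ (⊑-trans p q)
⊑-trans p (⊑-∧ˡ q) = ⊑-∧ˡ (⊑-trans p q)
⊑-trans p (⊑-∧ʳ q) = ⊑-∧ʳ (⊑-trans p q)
⊑-trans p (⊑-X q)  = ⊑-X (⊑-trans p q)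
⊑-trans p (⊑-Uˡ q) = ⊑-Uˡ (⊑-trans p q)
⊑-trans p (⊑-Uʳ q) = ⊑-Uʳ (⊑-trans p q)

mutual
  subformulas : Fml → List Fml
  subformulas φ = φ ∷ properSubformulas φ

  properSubformulas : Fml → List Fml
  properSubformulas (atom _) = []
  properSubformulas (¬' α)   = subformulas α
  properSubformulas (α ∧' β) = subformulas α ++ subformulas β
  properSubformulas (X α)    = subformulas α
  properSubformulas (α U β)  = subformulas α ++ subformulas β

⊑⇒∈subformulas : ∀ {ψ φ} → ψ ⊑ φ → ψ ∈ subformulas φ
⊑⇒∈subformulas ⊑-refl           = here refl
⊑⇒∈subformulas (⊑-¬ p)          = there (⊑⇒∈subformulas p)
⊑⇒∈subformulas (⊑-∧ˡ p)         = there (∈-++⁺ˡ (⊑⇒∈subformulas p))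
⊑⇒∈subformulas (⊑-∧ʳ {α} p)     = there (∈-++⁺ʳ (subformulas α) (⊑⇒∈subformulas p))
⊑⇒∈subformulas (⊑-X p)          = there (⊑⇒∈subformulas p)
⊑⇒∈subformulas (⊑-Uˡ p)         = there (∈-++⁺ˡ (⊑⇒∈subformulas p))
⊑⇒∈subformulas (⊑-Uʳ {α} p)     = there (∈-++⁺ʳ (subformulas α) (⊑⇒∈subformulas p))

data Closure (φ : Fml) : Fml → Set where
  sub   : ∀ {ψ} → ψ ⊑ φ → Closure φ ψ
  neg   : ∀ {ψ} → ψ ⊑ φ → Closure φ (¬' ψ)
  next  : ∀ {α β} → α U β ⊑ φ → Closure φ (X (α U β))
  ¬next : ∀ {α β} → α U β ⊑ φ → Closure φ (¬' (X (α U β)))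

closure : Fml → List Fml
closure φ = subformulas φ ++ map ¬' (subformulas φ) ++ map X (subformulas φ)
            ++ map (¬' ∘ X) (subformulas φ)

Closure⇒∈closure : ∀ {φ ψ} → Closure φ ψ → ψ ∈ closure φ
Closure⇒∈closure (sub p) = ∈-++⁺ˡ (⊑⇒∈subformulas p)
Closure⇒∈closure {φ} (neg p) =
  ∈-++⁺ʳ (subformulas φ) (∈-++⁺ˡ (∈-map⁺ ¬' (⊑⇒∈subformulas p)))
Closure⇒∈closure {φ} (next p) =
  ∈-++⁺ʳ (subformulas φ) (∈-++⁺ʳ (map ¬' (subformulas φ))
    (∈-++⁺ˡ (∈-map⁺ X (⊑⇒∈subformulas p))))
Closure⇒∈closure {φ} (¬next p) =
  ∈-++⁺ʳ (subformulas φ) (∈-++⁺ʳ (map ¬' (subformulas φ))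
    (∈-++⁺ʳ (map X (subformulas φ)) (∈-map⁺ (¬' ∘ X) (⊑⇒∈subformulas p))))

Closure-⊑ : ∀ {φ ψ χ} → ψ ⊑ χ → Closure φ χ → Closure φ ψ
Closure-⊑ q (sub p)                 = sub (⊑-trans q p)
Closure-⊑ ⊑-refl (neg p)            = neg p
Closure-⊑ (⊑-¬ q) (neg p)           = sub (⊑-trans q p)
Closure-⊑ ⊑-refl (next p)           = next p
Closure-⊑ (⊑-X q) (next p)          = sub (⊑-trans q p)
Closure-⊑ ⊑-refl (¬next p)          = ¬next p
Closure-⊑ (⊑-¬ ⊑-refl) (¬next p)    = next p
Closure-⊑ (⊑-¬ (⊑-X q)) (¬next p)   = sub (⊑-trans q p)

Closure-U⇒⊑ : ∀ {φ α β} → Closure φ (α U β) → α U β ⊑ φ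
Closure-U⇒⊑ (sub p) = p

Closure-¬∧⇒⊑ : ∀ {φ α β} → Closure φ (¬' (α ∧' β)) → α ∧' β ⊑ φ
Closure-¬∧⇒⊑ (sub p) = ⊑-trans (⊑-¬ ⊑-refl) p
Closure-¬∧⇒⊑ (neg p) = p

Closure-¬U⇒⊑ : ∀ {φ α β} → Closure φ (¬' (α U β)) → α U β ⊑ φ
Closure-¬U⇒⊑ (sub p) = ⊑-trans (⊑-¬ ⊑-refl) p
Closure-¬U⇒⊑ (neg p) = p

Closure-¬X : ∀ {φ α} → Closure φ (¬' (X α)) → Closure φ (¬' α)
Closure-¬X (sub p)   = neg (⊑-trans (⊑-¬ (⊑-X ⊑-refl)) p)
Closure-¬X (neg p)   = neg (⊑-trans (⊑-X ⊑-refl) p)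
Closure-¬X (¬next p) = neg p

Closed : Fml → Label → Set
Closed φ Γ = ∀ {ψ} → ψ ∈ Γ → Closure φ ψ

staticSize : Fml → ℕ
staticSize (atom _) = 0
staticSize (¬' α)   = suc (staticSize α)
staticSize (α ∧' β) = suc (staticSize α + staticSize β)
staticSize (X _)    = 0
staticSize (α U β)  = suc (staticSize α + staticSize β)

data Expansion (Γ Δ : Label) : Set where
  expand : ∀ {f added} → f ∈ Γ → ¬ Elementary f → IsRuleChild Γ f added Δ →
           All (λ ψ → staticSize ψ < staticSize f) added →
           (∀ {φ} → Closure φ f → All (Closure φ) added) → Expansion Γ Δ

expansion : ∀ {Γ Δ} → StaticChild Γ Δ → Expansion Γ Δ
expansion (dneg f∈Γ child) =
  expand f∈Γ (λ ()) child (s≤s (n≤1+n _) ∷ [])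
    λ c → Closure-⊑ (⊑-¬ (⊑-¬ ⊑-refl)) c ∷ []
expansion (con f∈Γ child) =
  expand f∈Γ (λ ()) child (s≤s (m≤m+n _ _) ∷ s≤s (m≤n+m _ _) ∷ [])
    λ c → Closure-⊑ (⊑-∧ˡ ⊑-refl) c ∷ Closure-⊑ (⊑-∧ʳ ⊑-refl) c ∷ []
expansion (dis₁ f∈Γ child) =
  expand f∈Γ (λ ()) child (s≤s (s≤s (m≤m+n _ _)) ∷ [])
    λ c → neg (⊑-trans (⊑-∧ˡ ⊑-refl) (Closure-¬∧⇒⊑ c)) ∷ []
expansion (dis₂ f∈Γ child) =
  expand f∈Γ (λ ()) child (s≤s (s≤s (m≤n+m _ _)) ∷ [])
    λ c → neg (⊑-trans (⊑-∧ʳ ⊑-refl) (Closure-¬∧⇒⊑ c)) ∷ []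
expansion (unt₁ f∈Γ child) =
  expand f∈Γ (λ ()) child (s≤s (m≤n+m _ _) ∷ [])
    λ c → Closure-⊑ (⊑-Uʳ ⊑-refl) c ∷ []
expansion (unt₂ f∈Γ child) =
  expand f∈Γ (λ ()) child (s≤s (m≤m+n _ _) ∷ z<s ∷ [])
    λ c → Closure-⊑ (⊑-Uˡ ⊑-refl) c ∷ next (Closure-U⇒⊑ c) ∷ []
expansion (nunt₁ f∈Γ child) =
  expand f∈Γ (λ ()) child (s≤s (s≤s (m≤m+n _ _)) ∷ s≤s (s≤s (m≤n+m _ _)) ∷ [])
    λ c → neg (⊑-trans (⊑-Uˡ ⊑-refl) (Closure-¬U⇒⊑ c))
        ∷ neg (⊑-trans (⊑-Uʳ ⊑-refl) (Closure-¬U⇒⊑ c)) ∷ []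
expansion (nunt₂ f∈Γ child) =
  expand f∈Γ (λ ()) child (s≤s (s≤s (m≤n+m _ _)) ∷ s≤s z<s ∷ [])
    λ c → neg (⊑-trans (⊑-Uʳ ⊑-refl) (Closure-¬U⇒⊑ c)) ∷ ¬next (Closure-¬U⇒⊑ c) ∷ []

Expansion-consumes : ∀ {Γ Δ} → Expansion Γ Δ → ∃ (Consumes staticSize Γ Δ)
Expansion-consumes {Γ} {Δ} (expand {f} {added} f∈Γ _ child smaller _) =
  f , record { consumed∈ = f∈Γ ; consumed∉ = f∉Δ ; fresh-lower = fresh-lower }
  where
  f∉Δ : f ∉ Δ
  f∉Δ f∈Δ with proj₁ (child f) f∈Δ
  ... | inj₁ f∈added   = <-irrefl refl (All.lookup smaller f∈added)
  ... | inj₂ (_ , f≢f) = f≢f refl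

  fresh-lower : ∀ {ψ} → ψ ∈ Δ → ψ ∈ Γ ⊎ staticSize ψ < staticSize f
  fresh-lower ψ∈Δ with proj₁ (child _) ψ∈Δ
  ... | inj₁ ψ∈added   = inj₂ (All.lookup smaller ψ∈added)
  ... | inj₂ (ψ∈Γ , _) = inj₁ ψ∈Γ

Expansion-closed : ∀ {φ Γ Δ} → Expansion Γ Δ → Closed φ Γ → Closed φ Δ
Expansion-closed (expand f∈Γ _ child _ closed-added) Γ-closed ψ∈Δ with proj₁ (child _) ψ∈Δ
... | inj₁ ψ∈added   = All.lookup (closed-added (Γ-closed f∈Γ)) ψ∈added
... | inj₂ (ψ∈Γ , _) = Γ-closed ψ∈Γ

poised⇒¬Expansion : ∀ {Γ Δ} → Poised Γ → ¬ Expansion Γ Δ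
poised⇒¬Expansion (_ , _ , elementary) (expand f∈Γ compound _ _ _) =
  compound (All.lookup elementary f∈Γ)

TransChild-closed : ∀ {φ Γ Δ} → TransChild Γ Δ → Closed φ Γ → Closed φ Δ
TransChild-closed child Γ-closed ψ∈Δ with proj₁ (child _) ψ∈Δ
... | inj₁ Xψ∈Γ              = Closure-⊑ (⊑-X ⊑-refl) (Γ-closed Xψ∈Γ)
... | inj₂ (_ , refl , ¬Xα∈Γ) = Closure-¬X (Γ-closed ¬Xα∈Γ)

data Fulfilled (B : Branch) (u v : ℕ) : Fml → Set where
  fulfilled : ∀ {α β} → FulfilledIn B u v β → Fulfilled B u v (X (α U β))

Fulfilled-X⁻ : ∀ {B u v α β} → Fulfilled B u v (X (α U β)) → FulfilledIn B u v β
Fulfilled-X⁻ (fulfilled f) = f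

Fulfilled-mono : ∀ {B u v w ψ} → v ≤ w → Fulfilled B u v ψ → Fulfilled B u w ψ
Fulfilled-mono v≤w (fulfilled (k , u<k , k≤v , β∈Bk)) =
  fulfilled (k , u<k , ≤-trans k≤v v≤w , β∈Bk)

FulfilledIn-widen : ∀ {B u v w β} → u < v → FulfilledIn B v w β → FulfilledIn B u w β
FulfilledIn-widen u<v (k , v<k , k≤w , β∈Bk) = k , <-trans u<v v<k , k≤w , β∈Bk

poised⇒¬Prune : ∀ {B w} → Poised (B w) → Continues B w → ¬ Prune B w
poised⇒¬Prune poised (inj₁ (_ , _ , child))  = ⊥-elim (poised⇒¬Expansion poised (expansion child))
poised⇒¬Prune _ (inj₂ (_ , _ , ¬prune , _)) = ¬prune

module _ {φ : Fml} {B : Branch} (root : B 0 ≋ [ φ ]) (continues : ∀ i → Continues B i) where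

  branch-closed : ∀ i → Closed φ (B i)
  branch-closed zero ψ∈B0 with proj₁ root ψ∈B0
  ... | here refl = sub ⊑-refl
  branch-closed (suc i) ψ∈B1+i with continues i
  ... | inj₁ (_ , _ , child)         = Expansion-closed (expansion child) (branch-closed i) ψ∈B1+i
  ... | inj₂ (_ , _ , _ , _ , child) = TransChild-closed child (branch-closed i) ψ∈B1+i

  labels⊆closure : ∀ i → B i ⊆ closure φ
  labels⊆closure i ψ∈Bi = Closure⇒∈closure (branch-closed i ψ∈Bi)

  poised-often : InfinitelyOften (Poised ∘ B)
  poised-often n no-poised =
    recurring-label L (closure φ) (λ k → labels⊆closure (k + n)) always
      λ (S , often , _ , repeated) → InfinitelyOften⇒pair often
      λ (i , j , i<j , Si , Sj) → consuming-run⇒¬⊆ staticSize L expanding i<j (repeated Si Sj)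
    where
    L : ℕ → Label
    L k = B (k + n)

    always : InfinitelyOften (λ _ → ⊤)
    always m k = k (m , ≤-refl , tt)

    expanding : ∀ k → ∃ (Consumes staticSize (L k) (L (suc k)))
    expanding k with continues (k + n)
    ... | inj₁ (_ , _ , child) = Expansion-consumes (expansion child)
    ... | inj₂ (poised , _)    = ⊥-elim (no-poised (k + n , m≤n+m n k , poised))

mainTheorem3 : (φ : Fml) (B : Branch) → ¬ InfiniteBranch φ B
mainTheorem3 φ B (root , continues) =
  recurring-label B (closure φ) (labels⊆closure root continues) (poised-often root continues)
    λ (S , often , poised , same) → often 0
    λ (u , _ , Su) →
      monotone-stabilises (Fulfilled B u) Fulfilled-mono (B u) (InfinitelyOften-≥ (suc u) often)
    λ (v , w , v<w , (u<v , Sv) , (_ , Sw) , nothing-new) →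
      poised⇒¬Prune (poised Sw) (continues w)
        ( u , v , u<v , v<w , poised Su
        , (same Su Sv , same Sv Su) , (same Sv Sw , same Sw Sv)
        , λ _ _ X[αUβ]∈Bw fulfilled-vw → Fulfilled-X⁻
            (nothing-new (same Sw Su X[αUβ]∈Bw) (fulfilled (FulfilledIn-widen u<v fulfilled-vw))))
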